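{- Let $\mathbf{A}$ be a finitely subdirectly irreducible De Morgan monoid that is not idempotent, and let $a\in A$ with $f^2\leqslant a$. Then $\neg a<a$ and the interval $[\neg a,a]=\{x\in A:\neg a\leqslant x\leqslant a\}$ is the universe of a subalgebra of $\mathbf{A}$. In particular, $[\neg(f^2),f^2]$ is the universe of a subalgebra of $\mathbf{A}$.
   Context: An involutive (commutative) residuated lattice (IRL) is an algebra $\langle A;\cdot,\wedge,\vee,\neg,e\rangle$ such that $\langle A;\cdot,e\rangle$ is a commutative monoid, $\langle A;\wedge,\vee\rangle$ is a lattice with order $\leqslant$, $\neg\neg x=x$, and $x\cdot y\leqslant z\iff \neg z\cdot y\leqslant\neg x$. Write $f:=\neg e$, $x^2:=x\cdot x$. A De Morgan monoid is an IRL with distributive lattice reduct satisfying $x\leqslant x^2$. An algebra is idempotent if all its elements satisfy $x^2=x$. An algebra is finitely subdirectly irreducible if its identity relation is meet-irreducible in its congruence lattice. Subalgebras are in the full signature $\cdot,\wedge,\vee,\neg,e$. -}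

module Defs where

open import Level using (Level; 0ℓ)
open import Data.Product using (_×_; _,_)
open import Data.Sum using (_⊎_)
open import Relation.Binary.PropositionalEquality using (_≡_)
open import Relation.Nullary using (¬_)

-- An involutive commutative residuated lattice with distributive lattice
-- reduct satisfying x ≤ x², i.e. a De Morgan monoid.
record DeMorganMonoid : Set₁ where
  infixl 7 _·_
  infixr 6 _∧_
  infixr 5 _∨_
  infix 4 _≤_ _<_
  infix 8 ∼_
  infixl 9 _²
  field
    Carrier : Set
    _·_ : Carrier → Carrier → Carrier
    _∧_ : Carrier → Carrier → Carrier
    _∨_ : Carrier → Carrier → Carrier
    ∼_  : Carrier → Carrier
    e   : Carrier

  _≤_ : Carrier → Carrier → Set
  x ≤ y = x ∧ y ≡ x

  field
    ·-assoc : ∀ x y z → (x · y) · z ≡ x · (y · z)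
    ·-comm  : ∀ x y → x · y ≡ y · x
    ·-identityˡ : ∀ x → e · x ≡ x
    ∧-assoc : ∀ x y z → (x ∧ y) ∧ z ≡ x ∧ (y ∧ z)
    ∨-assoc : ∀ x y z → (x ∨ y) ∨ z ≡ x ∨ (y ∨ z)
    ∧-comm  : ∀ x y → x ∧ y ≡ y ∧ x
    ∨-comm  : ∀ x y → x ∨ y ≡ y ∨ x
    ∧-absorbs-∨ : ∀ x y → x ∧ (x ∨ y) ≡ x
    ∨-absorbs-∧ : ∀ x y → x ∨ (x ∧ y) ≡ x
    ∧-distribˡ-∨ : ∀ x y z → x ∧ (y ∨ z) ≡ (x ∧ y) ∨ (x ∧ z)
    ∼-involutive : ∀ x → ∼ (∼ x) ≡ x
    residuation⇒ : ∀ x y z → x · y ≤ z → (∼ z) · y ≤ ∼ x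
    residuation⇐ : ∀ x y z → (∼ z) · y ≤ ∼ x → x · y ≤ z
    square-increasing : ∀ x → x ≤ x · x

  f : Carrier
  f = ∼ e

  _² : Carrier → Carrier
  x ² = x · x

  _<_ : Carrier → Carrier → Set
  x < y = x ≤ y × ¬ (x ≡ y)

  Idempotent : Set
  Idempotent = ∀ x → x ² ≡ x

  record IsCongruence (θ : Carrier → Carrier → Set) : Set where
    field
      refl  : ∀ {x} → θ x x
      sym   : ∀ {x y} → θ x y → θ y x
      trans : ∀ {x y z} → θ x y → θ y z → θ x z
      ·-cong : ∀ {x x′ y y′} → θ x x′ → θ y y′ → θ (x · y) (x′ · y′)
      ∧-cong : ∀ {x x′ y y′} → θ x x′ → θ y y′ → θ (x ∧ y) (x′ ∧ y′)
      ∨-cong : ∀ {x x′ y y′} → θ x x′ → θ y y′ → θ (x ∨ y) (x′ ∨ y′)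
      ∼-cong : ∀ {x x′} → θ x x′ → θ (∼ x) (∼ x′)

  IsIdentity : (Carrier → Carrier → Set) → Set
  IsIdentity θ = ∀ {x y} → θ x y → x ≡ y

  FinitelySubdirectlyIrreducible : Set₁
  FinitelySubdirectlyIrreducible =
    ∀ (θ ψ : Carrier → Carrier → Set) → IsCongruence θ → IsCongruence ψ →
      IsIdentity (λ x y → θ x y × ψ x y) → IsIdentity θ ⊎ IsIdentity ψ

  IsSubuniverse : (Carrier → Set) → Set
  IsSubuniverse S =
    (∀ {x y} → S x → S y → S (x · y)) ×
    (∀ {x y} → S x → S y → S (x ∧ y)) ×
    (∀ {x y} → S x → S y → S (x ∨ y)) ×
    (∀ {x} → S x → S (∼ x)) ×
    S e

  Interval : Carrier → Carrier → Carrier → Set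
  Interval b c x = b ≤ x × x ≤ c

module Submission where

-- For a negative element c
--    (c ≤ e) we have c² = c.  Hence, if f² ≤ a, then ∼a is a negative
--    idempotent, which forces a² ≤ a.  Any a with e, f ≤ a and a² ≤ a
--    bounds a subuniverse [∼a, a]: closure under · uses ∼a ≤ (∼a)², the
--    lattice operations and ∼ are routine, and ∼a ≤ e ≤ a.
--
-- For a negative element c, the relation
--    θ_c = {(x, y) : c·x ≤ y and c·y ≤ x} is a congruence; if e = c ∨ d
--    then θ_c ∩ θ_d is the identity, so FSI makes e join-prime.  As
--    e ≤ x ∨ ∼x always holds, e ≤ f² or f² ≤ f; the latter gives f ≤ e,
--    which makes A idempotent.  So a non-idempotent FSI algebra has e ≤ f².
--
-- The theorem combines the two: for a ≥ f² we get e ≤ f² ≤ a and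
-- f ≤ f² ≤ a, and ∼a = a would give f ≤ a ≤ e, i.e. idempotence.

open import Defs
open import Data.Product using (_×_; _,_; proj₂)
open import Data.Sum using (_⊎_; inj₁; inj₂)
open import Data.Empty using (⊥-elim)
open import Function using (_∘_)
open import Relation.Nullary using (¬_)
open import Relation.Binary.Bundles using (Poset)
import Relation.Binary.Reasoning.PartialOrder as PartialOrderReasoning
open import Relation.Binary.PropositionalEquality
  using (_≡_; refl; sym; trans; cong; cong₂; subst; subst₂; isEquivalence; module ≡-Reasoning)

module DeMorganMonoidTheory (𝐀 : DeMorganMonoid) where
  open DeMorganMonoid 𝐀 public

  ∧-idem : ∀ x → x ∧ x ≡ x
  ∧-idem x = trans (cong (x ∧_) (sym (∨-absorbs-∧ x x))) (∧-absorbs-∨ x (x ∧ x))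

  ≤-reflexive : ∀ {x y} → x ≡ y → x ≤ y
  ≤-reflexive {x} refl = ∧-idem x

  ≤-refl : ∀ {x} → x ≤ x
  ≤-refl = ≤-reflexive refl

  ≤-trans : ∀ {x y z} → x ≤ y → y ≤ z → x ≤ z
  ≤-trans {x} {y} {z} x≤y y≤z = begin
    x ∧ z       ≡⟨ cong (_∧ z) (sym x≤y) ⟩
    (x ∧ y) ∧ z ≡⟨ ∧-assoc x y z ⟩
    x ∧ (y ∧ z) ≡⟨ cong (x ∧_) y≤z ⟩
    x ∧ y       ≡⟨ x≤y ⟩
    x           ∎
    where open ≡-Reasoning

  ≤-antisym : ∀ {x y} → x ≤ y → y ≤ x → x ≡ y
  ≤-antisym {x} {y} x≤y y≤x = trans (sym x≤y) (trans (∧-comm x y) y≤x)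

  ≤-poset : Poset _ _ _
  ≤-poset = record
    { Carrier = Carrier
    ; _≈_ = _≡_
    ; _≤_ = _≤_
    ; isPartialOrder = record
      { isPreorder = record
        { isEquivalence = isEquivalence
        ; reflexive = ≤-reflexive
        ; trans = ≤-trans
        }
      ; antisym = ≤-antisym
      }
    }

  module ≤-Reasoning = PartialOrderReasoning ≤-poset

  ∧-lowerˡ : ∀ {x y} → x ∧ y ≤ x
  ∧-lowerˡ {x} {y} = begin
    (x ∧ y) ∧ x ≡⟨ ∧-assoc x y x ⟩
    x ∧ (y ∧ x) ≡⟨ cong (x ∧_) (∧-comm y x) ⟩
    x ∧ (x ∧ y) ≡⟨ sym (∧-assoc x x y) ⟩
    (x ∧ x) ∧ y ≡⟨ cong (_∧ y) (∧-idem x) ⟩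
    x ∧ y       ∎
    where open ≡-Reasoning

  ∧-lowerʳ : ∀ {x y} → x ∧ y ≤ y
  ∧-lowerʳ {x} {y} = subst (_≤ y) (∧-comm y x) ∧-lowerˡ

  ∧-greatest : ∀ {x y z} → z ≤ x → z ≤ y → z ≤ x ∧ y
  ∧-greatest {x} {y} {z} z≤x z≤y = trans (sym (∧-assoc z x y)) (trans (cong (_∧ y) z≤x) z≤y)

  ∨-upperˡ : ∀ {x y} → x ≤ x ∨ y
  ∨-upperˡ {x} {y} = ∧-absorbs-∨ x y

  ∨-upperʳ : ∀ {x y} → y ≤ x ∨ y
  ∨-upperʳ {x} {y} = subst (y ≤_) (∨-comm y x) ∨-upperˡ

  ∨-least : ∀ {x y z} → x ≤ z → y ≤ z → x ∨ y ≤ z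
  ∨-least {x} {y} {z} x≤z y≤z = begin
    (x ∨ y) ∧ z       ≡⟨ ∧-comm (x ∨ y) z ⟩
    z ∧ (x ∨ y)       ≡⟨ ∧-distribˡ-∨ z x y ⟩
    (z ∧ x) ∨ (z ∧ y) ≡⟨ cong₂ _∨_ (trans (∧-comm z x) x≤z) (trans (∧-comm z y) y≤z) ⟩
    x ∨ y             ∎
    where open ≡-Reasoning

  ·-identityʳ : ∀ x → x · e ≡ x
  ·-identityʳ x = trans (·-comm x e) (·-identityˡ x)

  ∼f≡e : ∼ f ≡ e
  ∼f≡e = ∼-involutive e

  ∼f-identity : ∀ x → ∼ f · x ≡ x
  ∼f-identity x = trans (cong (_· x) ∼f≡e) (·-identityˡ x)

  ∼-antitone : ∀ {x y} → x ≤ y → ∼ y ≤ ∼ x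
  ∼-antitone {x} {y} x≤y =
    subst (_≤ ∼ x) (·-identityʳ (∼ y))
      (residuation⇒ x e y (subst (_≤ y) (sym (·-identityʳ x)) x≤y))

  ∼-swap : ∀ {x y} → x ≤ ∼ y → y ≤ ∼ x
  ∼-swap {x} {y} x≤∼y = subst (_≤ ∼ x) (∼-involutive y) (∼-antitone x≤∼y)

  ∼-reflects : ∀ {x y} → ∼ x ≤ ∼ y → y ≤ x
  ∼-reflects {x} {y} ∼x≤∼y = subst (y ≤_) (∼-involutive x) (∼-swap ∼x≤∼y)

  ·-monoˡ : ∀ {x y z} → x ≤ y → x · z ≤ y · z
  ·-monoˡ {x} {y} {z} x≤y =
    residuation⇐ x z (y · z) (≤-trans (residuation⇒ y z (y · z) ≤-refl) (∼-antitone x≤y))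

  ·-monoʳ : ∀ {x y z} → x ≤ y → z · x ≤ z · y
  ·-monoʳ {x} {y} {z} x≤y = subst₂ _≤_ (·-comm x z) (·-comm y z) (·-monoˡ x≤y)

  ·-mono : ∀ {x x′ y y′} → x ≤ x′ → y ≤ y′ → x · y ≤ x′ · y′
  ·-mono x≤x′ y≤y′ = ≤-trans (·-monoˡ x≤x′) (·-monoʳ y≤y′)

  ·≤f⇒≤∼ : ∀ {x y} → x · y ≤ f → y ≤ ∼ x
  ·≤f⇒≤∼ {x} {y} xy≤f =
    subst (_≤ ∼ x) (∼f-identity y) (residuation⇒ x y f xy≤f)

  ≤∼⇒·≤f : ∀ {x y} → y ≤ ∼ x → x · y ≤ f
  ≤∼⇒·≤f {x} {y} y≤∼x =
    residuation⇐ x y f (subst (_≤ ∼ x) (sym (∼f-identity y)) y≤∼x)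

  ·∼≤f : ∀ {x} → x · ∼ x ≤ f
  ·∼≤f = ≤∼⇒·≤f ≤-refl

  ·∼≤f⇒≤ : ∀ {x y} → x · ∼ y ≤ f → x ≤ y
  ·∼≤f⇒≤ = ∼-reflects ∘ ·≤f⇒≤∼

  ·-∨-least : ∀ {u v w z} → u · w ≤ z → v · w ≤ z → (u ∨ v) · w ≤ z
  ·-∨-least {u} {v} {w} {z} uw≤z vw≤z =
    residuation⇐ (u ∨ v) w z
      (≤-trans (∧-greatest (residuation⇒ u w z uw≤z) (residuation⇒ v w z vw≤z)) deMorgan)
    where
    deMorgan : ∼ u ∧ ∼ v ≤ ∼ (u ∨ v)
    deMorgan = ∼-swap (∨-least (∼-swap ∧-lowerˡ) (∼-swap ∧-lowerʳ))

  ·-interchange : ∀ a b c d → (a · b) · (c · d) ≡ (a · c) · (b · d)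
  ·-interchange a b c d = begin
    (a · b) · (c · d) ≡⟨ ·-assoc a b (c · d) ⟩
    a · (b · (c · d)) ≡⟨ cong (a ·_) (sym (·-assoc b c d)) ⟩
    a · ((b · c) · d) ≡⟨ cong (λ w → a · (w · d)) (·-comm b c) ⟩
    a · ((c · b) · d) ≡⟨ cong (a ·_) (·-assoc c b d) ⟩
    a · (c · (b · d)) ≡⟨ sym (·-assoc a c (b · d)) ⟩
    (a · c) · (b · d) ∎
    where open ≡-Reasoning

  negative⇒idempotent : ∀ {c} → c ≤ e → c ² ≡ c
  negative⇒idempotent {c} c≤e =
    ≤-antisym (≤-trans (·-monoʳ c≤e) (≤-reflexive (·-identityʳ c))) (square-increasing c)

  -- e ≤ x ∨ ∼x, since ∼(x ∨ ∼x) ≤ (∼(x ∨ ∼x))² ≤ x·∼x ≤ f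
  e≤x∨∼x : ∀ x → e ≤ x ∨ ∼ x
  e≤x∨∼x x = ∼-reflects (begin
    ∼ y          ≤⟨ square-increasing (∼ y) ⟩
    ∼ y · ∼ y    ≤⟨ ·-mono ∼y≤x (∼-antitone ∨-upperˡ) ⟩
    x · ∼ x      ≤⟨ ·∼≤f ⟩
    f            ∎)
    where
    open ≤-Reasoning
    y : Carrier
    y = x ∨ ∼ x
    ∼y≤x : ∼ y ≤ x
    ∼y≤x = subst (∼ y ≤_) (∼-involutive x) (∼-antitone ∨-upperʳ)

  -- f ≤ e forces idempotence: x·∼x ≤ f ≤ e is negative, so
  -- x²·∼x ≤ (x·∼x)² = x·∼x ≤ f, i.e. x² ≤ x.
  f≤e⇒idempotent : f ≤ e → Idempotent
  f≤e⇒idempotent f≤e x = ≤-antisym (·∼≤f⇒≤ x²∼x≤f) (square-increasing x)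
    where
    open ≤-Reasoning
    x∼x-idempotent : (x · ∼ x) ² ≡ x · ∼ x
    x∼x-idempotent = negative⇒idempotent (≤-trans ·∼≤f f≤e)
    x²∼x≤f : x ² · ∼ x ≤ f
    x²∼x≤f = begin
      x ² · ∼ x           ≤⟨ ·-monoʳ (square-increasing (∼ x)) ⟩
      x ² · (∼ x · ∼ x)   ≡⟨ ·-interchange x x (∼ x) (∼ x) ⟩
      (x · ∼ x) ²         ≡⟨ x∼x-idempotent ⟩
      x · ∼ x             ≤⟨ ·∼≤f ⟩
      f                   ∎

  f²≤f⇒f≤e : f ² ≤ f → f ≤ e
  f²≤f⇒f≤e f²≤f = subst₂ _≤_ (∼f-identity f) ∼f≡e (residuation⇒ f f f f²≤f)

  f≤⇒∼≤e : ∀ {a} → f ≤ a → ∼ a ≤ e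
  f≤⇒∼≤e f≤a = ≤-trans (∼-antitone f≤a) (≤-reflexive ∼f≡e)

  -- If f² ≤ a then a² ≤ a.  With n = ∼a we have n ≤ e, so n² = n, and
  -- a²·n = (a·n)²·n ≤ f²·n ≤ f, the last step because f² ≤ a = ∼n.
  above-f²⇒square≤ : ∀ {a} → f ² ≤ a → a ² ≤ a
  above-f²⇒square≤ {a} f²≤a = ·∼≤f⇒≤ (begin
    a ² · n                 ≡⟨ cong (a ² ·_) (sym n²≡n) ⟩
    a ² · n ²               ≡⟨ sym (·-assoc (a ²) n n) ⟩
    (a ² · n) · n           ≡⟨ cong (_· n) (trans (cong (a ² ·_) (sym n²≡n)) (·-interchange a a n n)) ⟩
    (a · n) ² · n           ≤⟨ ·-monoˡ (·-mono ·∼≤f ·∼≤f) ⟩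
    f ² · n                 ≡⟨ ·-comm (f ²) n ⟩
    n · f ²                 ≤⟨ ≤∼⇒·≤f (subst (f ² ≤_) (sym (∼-involutive a)) f²≤a) ⟩
    f                       ∎)
    where
    open ≤-Reasoning
    n : Carrier
    n = ∼ a
    n²≡n : n ² ≡ n
    n²≡n = negative⇒idempotent (f≤⇒∼≤e (≤-trans (square-increasing f) f²≤a))

  interval-subuniverse : ∀ {a} → e ≤ a → f ≤ a → a ² ≤ a → IsSubuniverse (Interval (∼ a) a)
  interval-subuniverse {a} e≤a f≤a a²≤a =
      (λ (∼a≤x , x≤a) (∼a≤y , y≤a) →
          ≤-trans (square-increasing (∼ a)) (·-mono ∼a≤x ∼a≤y) , ≤-trans (·-mono x≤a y≤a) a²≤a)
    , (λ (∼a≤x , x≤a) (∼a≤y , _) → ∧-greatest ∼a≤x ∼a≤y , ≤-trans ∧-lowerˡ x≤a)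
    , (λ (∼a≤x , x≤a) (_ , y≤a) → ≤-trans ∼a≤x ∨-upperˡ , ∨-least x≤a y≤a)
    , (λ (∼a≤x , x≤a) → ∼-antitone x≤a , subst (∼ _ ≤_) (∼-involutive a) (∼-antitone ∼a≤x))
    , (f≤⇒∼≤e f≤a , e≤a)

  -- the strict inequality ∼a < a: ∼a = a would give f ≤ a = ∼a ≤ ∼f = e
  ∼-below : ¬ Idempotent → ∀ {a} → e ≤ a → f ≤ a → ∼ a < a
  ∼-below nonIdempotent {a} e≤a f≤a = ≤-trans ∼a≤e e≤a , ∼a≢a
    where
    ∼a≤e : ∼ a ≤ e
    ∼a≤e = f≤⇒∼≤e f≤a
    ∼a≢a : ¬ (∼ a ≡ a)
    ∼a≢a ∼a≡a = nonIdempotent (f≤e⇒idempotent (≤-trans f≤a (subst (_≤ e) ∼a≡a ∼a≤e)))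

  θ : Carrier → Carrier → Carrier → Set
  θ c x y = c · x ≤ y × c · y ≤ x

  θ-isCongruence : ∀ {c} → c ≤ e → IsCongruence (θ c)
  θ-isCongruence {c} c≤e = record
    { refl = cx≤x , cx≤x
    ; sym = λ (cx≤y , cy≤x) → cy≤x , cx≤y
    ; trans = λ (cx≤y , cy≤x) (cy≤z , cz≤y) → chain cx≤y cy≤z , chain cz≤y cy≤x
    ; ·-cong = λ (cx≤x′ , cx′≤x) (cy≤y′ , cy′≤y) → ·-step cx≤x′ cy≤y′ , ·-step cx′≤x cy′≤y
    ; ∧-cong = λ (cx≤x′ , cx′≤x) (cy≤y′ , cy′≤y) → ∧-step cx≤x′ cy≤y′ , ∧-step cx′≤x cy′≤y
    ; ∨-cong = λ (cx≤x′ , cx′≤x) (cy≤y′ , cy′≤y) → ∨-step cx≤x′ cy≤y′ , ∨-step cx′≤x cy′≤y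
    ; ∼-cong = λ (cx≤x′ , cx′≤x) → ∼-step cx′≤x , ∼-step cx≤x′
    }
    where
    open ≤-Reasoning
    c²≡c : c ² ≡ c
    c²≡c = negative⇒idempotent c≤e
    cx≤x : ∀ {x} → c · x ≤ x
    cx≤x {x} = ≤-trans (·-monoˡ c≤e) (≤-reflexive (·-identityˡ x))
    chain : ∀ {x y z} → c · x ≤ y → c · y ≤ z → c · x ≤ z
    chain {x} {y} {z} cx≤y cy≤z = begin
      c · x         ≡⟨ cong (_· x) (sym c²≡c) ⟩
      (c · c) · x   ≡⟨ ·-assoc c c x ⟩
      c · (c · x)   ≤⟨ ·-monoʳ cx≤y ⟩
      c · y         ≤⟨ cy≤z ⟩
      z             ∎
    ·-step : ∀ {x x′ y y′} → c · x ≤ x′ → c · y ≤ y′ → c · (x · y) ≤ x′ · y′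
    ·-step {x} {x′} {y} {y′} cx≤x′ cy≤y′ = begin
      c · (x · y)         ≡⟨ cong (_· (x · y)) (sym c²≡c) ⟩
      (c · c) · (x · y)   ≡⟨ ·-interchange c c x y ⟩
      (c · x) · (c · y)   ≤⟨ ·-mono cx≤x′ cy≤y′ ⟩
      x′ · y′             ∎
    ∧-step : ∀ {x x′ y y′} → c · x ≤ x′ → c · y ≤ y′ → c · (x ∧ y) ≤ x′ ∧ y′
    ∧-step cx≤x′ cy≤y′ =
      ∧-greatest (≤-trans (·-monoʳ ∧-lowerˡ) cx≤x′) (≤-trans (·-monoʳ ∧-lowerʳ) cy≤y′)
    ∨-step : ∀ {x x′ y y′} → c · x ≤ x′ → c · y ≤ y′ → c · (x ∨ y) ≤ x′ ∨ y′
    ∨-step {x} {x′} {y} {y′} cx≤x′ cy≤y′ = subst (_≤ x′ ∨ y′) (·-comm (x ∨ y) c)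
      (·-∨-least (subst (_≤ x′ ∨ y′) (·-comm c x) (≤-trans cx≤x′ ∨-upperˡ))
                 (subst (_≤ x′ ∨ y′) (·-comm c y) (≤-trans cy≤y′ ∨-upperʳ)))
    ∼-step : ∀ {x x′} → c · x′ ≤ x → c · ∼ x ≤ ∼ x′
    ∼-step {x} {x′} cx′≤x = subst (_≤ ∼ x′) (·-comm (∼ x) c)
      (residuation⇒ x′ c x (subst (_≤ x) (·-comm c x′) cx′≤x))

  -- if θ c is the identity then c = e, because (e, c) ∈ θ c
  θ-identity⇒≡e : ∀ {c} → c ≤ e → IsIdentity (θ c) → e ≡ c
  θ-identity⇒≡e {c} c≤e identity =
    identity (≤-reflexive (·-identityʳ c) , ≤-trans (≤-reflexive (negative⇒idempotent c≤e)) c≤e)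

  -- Put c = e ∧ p and d = e ∧ q, so
  -- c ∨ d = e by distributivity; if (x, y) ∈ θ c ∩ θ d then
  -- x = (c ∨ d)·x ≤ y and symmetrically, so θ c ∩ θ d is the identity.
  FSI⇒e-join-prime : FinitelySubdirectlyIrreducible →
                     ∀ {p q} → e ≤ p ∨ q → e ≤ p ⊎ e ≤ q
  FSI⇒e-join-prime fsi {p} {q} e≤p∨q
    with fsi (θ c) (θ d) (θ-isCongruence ∧-lowerˡ) (θ-isCongruence ∧-lowerˡ) meet-identity
    where
    c d : Carrier
    c = e ∧ p
    d = e ∧ q
    c∨d≡e : c ∨ d ≡ e
    c∨d≡e = trans (sym (∧-distribˡ-∨ e p q)) e≤p∨q
    below-both : ∀ {x y} → c · x ≤ y → d · x ≤ y → x ≤ y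
    below-both {x} cx≤y dx≤y =
      ≤-trans (≤-reflexive (sym (trans (cong (_· x) c∨d≡e) (·-identityˡ x)))) (·-∨-least cx≤y dx≤y)
    meet-identity : IsIdentity (λ x y → θ c x y × θ d x y)
    meet-identity ((cx≤y , cy≤x) , (dx≤y , dy≤x)) =
      ≤-antisym (below-both cx≤y dx≤y) (below-both cy≤x dy≤x)
  ... | inj₁ θc-identity = inj₁ (subst (_≤ p) (sym (θ-identity⇒≡e ∧-lowerˡ θc-identity)) ∧-lowerʳ)
  ... | inj₂ θd-identity = inj₂ (subst (_≤ q) (sym (θ-identity⇒≡e ∧-lowerˡ θd-identity)) ∧-lowerʳ)

  -- In a non-idempotent FSI algebra e ≤ f²: otherwise e ≤ ∼(f²) by
  -- join-primality applied to e ≤ f² ∨ ∼(f²), i.e. f² ≤ f, so f ≤ e.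
  FSI⇒e≤f² : FinitelySubdirectlyIrreducible → ¬ Idempotent → e ≤ f ²
  FSI⇒e≤f² fsi nonIdempotent with FSI⇒e-join-prime fsi (e≤x∨∼x (f ²))
  ... | inj₁ e≤f² = e≤f²
  ... | inj₂ e≤∼f² = ⊥-elim (nonIdempotent (f≤e⇒idempotent (f²≤f⇒f≤e (∼-swap e≤∼f²))))

theorem5p15 : (𝐀 : DeMorganMonoid) →
    let open DeMorganMonoid 𝐀 in
    FinitelySubdirectlyIrreducible → ¬ Idempotent →
    ((a : Carrier) → f ² ≤ a →
    (∼ a < a) × IsSubuniverse (Interval (∼ a) a))
    × IsSubuniverse (Interval (∼ (f ²)) (f ²))
theorem5p15 𝐀 fsi nonIdempotent = above-f² , proj₂ (above-f² (f ²) ≤-refl)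
  where
  open DeMorganMonoidTheory 𝐀
  above-f² : (a : Carrier) → f ² ≤ a → (∼ a < a) × IsSubuniverse (Interval (∼ a) a)
  above-f² a f²≤a =
    ∼-below nonIdempotent e≤a f≤a , interval-subuniverse e≤a f≤a (above-f²⇒square≤ f²≤a)
    where
    e≤a : e ≤ a
    e≤a = ≤-trans (FSI⇒e≤f² fsi nonIdempotent) f²≤a
    f≤a : f ≤ a
    f≤a = ≤-trans (square-increasing f) f²≤a
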